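{- For all graphs $A$ and $B$: $\vdash_{\mathsf{GS}} A\otimes B$ if and only if $\vdash_{\mathsf{GS}}A$ and $\vdash_{\mathsf{GS}}B$.
   Context: Atoms: a countable set $\mathcal V$ of variables and a disjoint copy $\overline{\mathcal V}$; atoms are elements of $\mathcal V\cup\overline{\mathcal V}$, with $\overline{\overline a}=a$. A graph is a finite simple undirected graph with vertices labelled by atoms, identified up to label-preserving isomorphism; $\emptyset$ is the empty graph; $a$ also denotes a one-vertex graph. $G\sqcup H$ is disjoint union; $G\otimes H$ is disjoint union plus all edges between $V_G$ and $V_H$. $\overline G$: same vertices, complementary edges, dual labels. A context is a graph $C$ with $R\subseteq V_C$; $C[M]_R$ is $C\sqcup M$ plus all edges between $V_M$ and $R$. A module of $G$ is an induced subgraph $M$ with every outside vertex adjacent to all or none of $M$; $P$ is prime if $|V_P|\ge2$ and its only modules are $\emptyset$, singletons and $P$. For $G$ with vertices $v_1,\dots,v_n$, $G\langle H_1,\dots,H_n\rangle$ replaces $v_i$ by $H_i$, keeps internal edges, joins $H_i$ to $H_j$ ($i\ne j$) iff $v_iv_j\in E_G$; $\overline G\langle\cdots\rangle$ uses the same vertex order. Rules of $\mathsf{GS}$: $\mathsf{ai}{\downarrow}$: $\emptyset\longrightarrow\overline a\sqcup a$; $\mathsf{ss}{\downarrow}$: $B[A]_S\longrightarrow B\sqcup A$, $S\subseteq V_B$, $S\ne\emptyset$, $A\ne\emptyset$; $\mathsf{p}{\downarrow}$: $(M_1\sqcup N_1)\otimes\cdots\otimes(M_n\sqcup N_n)\longrightarrow\overline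 P\langle M_1,\dots,M_n\rangle\sqcup P\langle N_1,\dots,N_n\rangle$, $P$ prime, $n=|V_P|\ge4$, all $M_i\ne\emptyset$. $\vdash_{\mathsf{GS}}X$ means there is a finite sequence of graphs from $\emptyset$ to $X$ each step of which is a label-preserving isomorphism or replaces $C[X']_R$ by $C[Y']_R$ for a context and a rule instance $X'\longrightarrow Y'$. -}

module Defs where

open import Data.Nat using (ℕ; zero; suc; _+_; _≤_)
open import Data.Bool using (Bool; true; false; not; if_then_else_)
open import Data.Fin using (Fin; zero; suc; splitAt; _≟_)
open import Data.Fin.Subset using (Subset; _∈_; _∉_; ∣_∣; Nonempty)
open import Data.Sum using (_⊎_; inj₁; inj₂)
open import Data.Product using (Σ; ∃; _×_; _,_; proj₁; proj₂)
open import Data.Empty using (⊥-elim)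
open import Relation.Nullary using (yes; no; ¬_)
open import Relation.Binary.PropositionalEquality using (_≡_; refl; sym)
open import Relation.Binary.Construct.Closure.ReflexiveTransitive using (Star)
open import Data.Vec using (lookup)

data Atom : Set where
  pos : ℕ → Atom
  neg : ℕ → Atom

dual : Atom → Atom
dual (pos x) = neg x
dual (neg x) = pos x

-- Finite simple undirected atom-labelled graphs on vertex set Fin size.
-- (Graphs are identified up to label-preserving isomorphism via _≅_.)

record Graph : Set where
  field
    size  : ℕ
    lab   : Fin size → Atom
    E     : Fin size → Fin size → Bool
    E-sym : ∀ i j → E i j ≡ E j i
    E-irr : ∀ i → E i i ≡ false
open Graph public

infix 4 _≅_
record _≅_ (G H : Graph) : Set where
  field
    to      : Fin (size G) → Fin (size H)
    from    : Fin (size H) → Fin (size G)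
    to-from : ∀ y → to (from y) ≡ y
    from-to : ∀ x → from (to x) ≡ x
    lab-pres : ∀ x → lab H (to x) ≡ lab G x
    E-pres  : ∀ x y → E H (to x) (to y) ≡ E G x y

∅ : Graph
∅ = record { size = 0 ; lab = λ () ; E = λ () ; E-sym = λ () ; E-irr = λ () }

atom : Atom → Graph
atom a = record { size = 1 ; lab = λ _ → a ; E = λ _ _ → false
                ; E-sym = λ _ _ → refl ; E-irr = λ _ → refl }

module _ {m n : ℕ} (E₁ : Fin m → Fin m → Bool) (E₂ : Fin n → Fin n → Bool)
         (cross : Fin m → Fin n → Bool) where
  sumE : Fin m ⊎ Fin n → Fin m ⊎ Fin n → Bool
  sumE (inj₁ i) (inj₁ j) = E₁ i j
  sumE (inj₂ i) (inj₂ j) = E₂ i j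
  sumE (inj₁ i) (inj₂ j) = cross i j
  sumE (inj₂ i) (inj₁ j) = cross j i

  sumE-sym : (∀ i j → E₁ i j ≡ E₁ j i) → (∀ i j → E₂ i j ≡ E₂ j i) →
             ∀ u v → sumE u v ≡ sumE v u
  sumE-sym s₁ s₂ (inj₁ i) (inj₁ j) = s₁ i j
  sumE-sym s₁ s₂ (inj₂ i) (inj₂ j) = s₂ i j
  sumE-sym s₁ s₂ (inj₁ i) (inj₂ j) = refl
  sumE-sym s₁ s₂ (inj₂ i) (inj₁ j) = refl

  sumE-irr : (∀ i → E₁ i i ≡ false) → (∀ i → E₂ i i ≡ false) →
             ∀ u → sumE u u ≡ false
  sumE-irr r₁ r₂ (inj₁ i) = r₁ i
  sumE-irr r₁ r₂ (inj₂ i) = r₂ i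

sumLab : ∀ {m n} → (Fin m → Atom) → (Fin n → Atom) → Fin m ⊎ Fin n → Atom
sumLab l₁ l₂ (inj₁ i) = l₁ i
sumLab l₁ l₂ (inj₂ i) = l₂ i

glue : (G H : Graph) → (Fin (size G) → Fin (size H) → Bool) → Graph
glue G H cross = record
  { size  = size G + size H
  ; lab   = λ u → sumLab (lab G) (lab H) (splitAt (size G) u)
  ; E     = λ u v → sumE (E G) (E H) cross (splitAt (size G) u) (splitAt (size G) v)
  ; E-sym = λ u v → sumE-sym (E G) (E H) cross (E-sym G) (E-sym H)
                      (splitAt (size G) u) (splitAt (size G) v)
  ; E-irr = λ u → sumE-irr (E G) (E H) cross (E-irr G) (E-irr H) (splitAt (size G) u)
  }

_⊔_ : Graph → Graph → Graph
G ⊔ H = glue G H (λ _ _ → false)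

_⊗_ : Graph → Graph → Graph
G ⊗ H = glue G H (λ _ _ → true)

infixr 6 _⊔_
infixr 7 _⊗_
infix 8 _[_]⟨_⟩

_[_]⟨_⟩ : (C : Graph) → Graph → Subset (size C) → Graph
C [ M ]⟨ R ⟩ = glue C M (λ c _ → lookup R c)

compE : ∀ {n} → (Fin n → Fin n → Bool) → Fin n → Fin n → Bool
compE E i j with i ≟ j
... | yes _ = false
... | no  _ = not (E i j)

compE-sym : ∀ {n} (E : Fin n → Fin n → Bool) → (∀ i j → E i j ≡ E j i) →
            ∀ i j → compE E i j ≡ compE E j i
compE-sym E s i j with i ≟ j | j ≟ i
... | yes _ | yes _ = refl
... | yes p | no ¬q = ⊥-elim (¬q (sym p))
... | no ¬p | yes q = ⊥-elim (¬p (sym q))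
... | no _  | no _  rewrite s i j = refl

compE-irr : ∀ {n} (E : Fin n → Fin n → Bool) → ∀ i → compE E i i ≡ false
compE-irr E i with i ≟ i
... | yes _ = refl
... | no ¬p = ⊥-elim (¬p refl)

‾_ : Graph → Graph
‾ G = record { size = size G ; lab = λ i → dual (lab G i) ; E = compE (E G)
             ; E-sym = compE-sym (E G) (E-sym G) ; E-irr = compE-irr (E G) }

-- Composition  G⟨H₁,…,Hₙ⟩ (vertex v_i of G replaced by H i)

sumF : ∀ {n} → (Fin n → ℕ) → ℕ
sumF {zero}  f = 0
sumF {suc n} f = f zero + sumF (λ i → f (suc i))

decode : ∀ {n} (f : Fin n → ℕ) → Fin (sumF f) → Σ (Fin n) (λ i → Fin (f i))
decode {zero}  f ()
decode {suc n} f u with splitAt (f zero) u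
... | inj₁ a = zero , a
... | inj₂ b with decode (λ i → f (suc i)) b
...   | i , c = suc i , c

module _ {n : ℕ} (G : Fin n → Fin n → Bool) (H : Fin n → Graph) where
  private V = Σ (Fin n) (λ i → Fin (size (H i)))

  compoE : V → V → Bool
  compoE (i , a) (j , b) with i ≟ j
  ... | yes refl = E (H i) a b
  ... | no  _    = G i j

  compoE-sym : (∀ i j → G i j ≡ G j i) → ∀ u v → compoE u v ≡ compoE v u
  compoE-sym s (i , a) (j , b) with i ≟ j | j ≟ i
  ... | yes refl | yes refl = E-sym (H i) a b
  ... | yes p    | no ¬q    = ⊥-elim (¬q (sym p))
  ... | no ¬p    | yes q    = ⊥-elim (¬p (sym q))
  ... | no _     | no _     = s i j

  compoE-irr : ∀ u → compoE u u ≡ false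
  compoE-irr (i , a) with i ≟ i
  ... | yes refl = E-irr (H i) a
  ... | no ¬p    = ⊥-elim (¬p refl)

_⟨_⟩ : (G : Graph) → (Fin (size G) → Graph) → Graph
G ⟨ H ⟩ = record
  { size  = sumF (λ i → size (H i))
  ; lab   = λ u → let (i , a) = dec u in lab (H i) a
  ; E     = λ u v → compoE (E G) H (dec u) (dec v)
  ; E-sym = λ u v → compoE-sym (E G) H (E-sym G) (dec u) (dec v)
  ; E-irr = λ u → compoE-irr (E G) H (dec u)
  }
  where dec = decode (λ i → size (H i))

⨂ : ∀ {n} → (Fin n → Graph) → Graph
⨂ {zero}  H = ∅
⨂ {suc n} H = H zero ⊗ ⨂ (λ i → H (suc i))

IsModule : (G : Graph) → Subset (size G) → Set
IsModule G S = ∀ v → v ∉ S →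
  (∀ x → x ∈ S → E G v x ≡ true) ⊎ (∀ x → x ∈ S → E G v x ≡ false)

Prime : Graph → Set
Prime P = 2 ≤ size P ×
  (∀ S → IsModule P S → ∣ S ∣ ≡ 0 ⊎ ∣ S ∣ ≡ 1 ⊎ ∣ S ∣ ≡ size P)

-- Rules of GS:  Rule X Y  means  X ⟶ Y  is a rule instance

data Rule : Graph → Graph → Set where
  ai↓ : (a : Atom) → Rule ∅ (atom (dual a) ⊔ atom a)
  ss↓ : (B A : Graph) (S : Subset (size B)) → Nonempty S → 1 ≤ size A →
        Rule (B [ A ]⟨ S ⟩) (B ⊔ A)
  p↓  : (P : Graph) → Prime P → 4 ≤ size P →
        (M N : Fin (size P) → Graph) → (∀ i → 1 ≤ size (M i)) →
        Rule (⨂ (λ i → M i ⊔ N i)) ((‾ P) ⟨ M ⟩ ⊔ P ⟨ N ⟩)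

data Step : Graph → Graph → Set where
  iso  : ∀ {G H} → G ≅ H → Step G H
  rule : ∀ {G H} (C : Graph) (R : Subset (size C)) {X Y : Graph} → Rule X Y →
         G ≅ C [ X ]⟨ R ⟩ → H ≅ C [ Y ]⟨ R ⟩ → Step G H

⊢GS_ : Graph → Set
⊢GS X = Star Step ∅ X

-- (⇐) Deriving A inside the context □ ⊗ B, after deriving B ≅ ∅ ⊗ B, derives A ⊗ B.
-- (⇒) Along a derivation, every splitting G ≅ A ⊗ B of the current graph has derivable factors.
-- The conclusion Y of each rule is co-connected (for p↓ because a prime graph on at least three
-- vertices is connected), so in a step C[X]_R ⟶ C[Y]_R ≅ A ⊗ B all of Y lies in one factor, say A.
-- The vertices C₂ of C lying in B are then joined to all of A, so C[-]_R = C₁[-]_R₁ ⊗ C₂ with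
-- C₂ ≅ B; the previous graph C₁[X]_R₁ ⊗ C₂ has derivable factors, and one more step derives A.
module Submission where

open import Defs
open import Data.Bool using (Bool; true; false; not; T)
open import Data.Bool.Properties using (T-irrelevant; ¬-not; not-¬) renaming (_≟_ to _≟ᵇ_)
open import Data.Empty using (⊥; ⊥-elim)
open import Data.Fin using (Fin; zero; suc; fromℕ<; splitAt; join; _↑ˡ_; _↑ʳ_; _≟_; punchIn)
open import Data.Fin.Properties
  using (¬Fin0; +↔⊎; 0↔⊥; 1↔⊤; splitAt-↑ˡ; splitAt-↑ʳ; any?; punchInᵢ≢i)
open import Data.Fin.Subset using (Subset; _∈_; _∉_; ∁; ⊤)
open import Data.Fin.Subset.Properties
  using (∣∁p∣≡n∸∣p∣; ∣p∣≡n⇒p≡⊤; ∈⊤; x∈p⇒x∉∁p; x∈∁p⇒x∉p; x∉∁p⇒x∈p)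
open import Data.Nat using (ℕ; zero; suc; _+_; _∸_; _≤_; s≤s)
open import Data.Nat.Properties using (n<1+n; n≤1+n; <-irrefl; ≤-trans)
open import Data.Product using (Σ; ∃; _×_; _,_; proj₁; proj₂) renaming (swap to ×-swap)
open import Data.Sum using (_⊎_; inj₁; inj₂; map; swap; [_,_]′)
open import Data.Sum.Algebra using (⊎-cong; ⊎-comm; ⊎-assoc)
open import Data.Unit using (tt)
open import Data.Vec using (lookup; tabulate; _++_)
open import Data.Vec.Properties
  using (lookup∘tabulate; []=⇒lookup; lookup⇒[]=; lookup-++ˡ; lookup-++ʳ; lookup-replicate)
open import Function.Bundles using (Inverse; _↔_; mk↔ₛ′; _⇔_; mk⇔)
open import Function.Properties.Inverse using (↔-refl; ↔-sym; ↔-trans)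
open import Level using (0ℓ)
open import Relation.Binary.Construct.Closure.ReflexiveTransitive using (Star; ε; _◅_; _◅◅_; gmap)
open import Relation.Binary.PropositionalEquality
  using (_≡_; refl; sym; trans; cong; cong₂; subst; module ≡-Reasoning)
open import Relation.Nullary using (yes; no; does; ¬_)
open import Relation.Nullary.Decidable using (dec-true; dec-false)

-- Gluing and restricting Graphs re-indexes Fin; on these graphs it is just ⊎ and Σ.
record LGraph : Set₁ where
  field
    Vertex : Set
    label  : Vertex → Atom
    edge   : Vertex → Vertex → Bool
open LGraph public

⟦_⟧ : Graph → LGraph
⟦ G ⟧ = record { Vertex = Fin (size G) ; label = lab G ; edge = E G }

infix 4 _≃_
record _≃_ (X Y : LGraph) : Set where
  field
    vertices   : Vertex X ↔ Vertex Y
  open Inverse vertices public using (to; from; strictlyInverseˡ; strictlyInverseʳ)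
  field
    label-pres : ∀ x → label Y (to x) ≡ label X x
    edge-pres  : ∀ x y → edge Y (to x) (to y) ≡ edge X x y
open _≃_ public

≃-refl : ∀ {X} → X ≃ X
≃-refl = record { vertices = ↔-refl ; label-pres = λ _ → refl ; edge-pres = λ _ _ → refl }

≃-sym : ∀ {X Y} → X ≃ Y → Y ≃ X
≃-sym {Y = Y} φ = record
  { vertices   = ↔-sym (vertices φ)
  ; label-pres = λ y → trans (sym (label-pres φ (from φ y))) (cong (label Y) (strictlyInverseˡ φ y))
  ; edge-pres  = λ x y → trans (sym (edge-pres φ (from φ x) (from φ y)))
                               (cong₂ (edge Y) (strictlyInverseˡ φ x) (strictlyInverseˡ φ y))
  }

≃-trans : ∀ {X Y Z} → X ≃ Y → Y ≃ Z → X ≃ Z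
≃-trans φ ψ = record
  { vertices   = ↔-trans (vertices φ) (vertices ψ)
  ; label-pres = λ x → trans (label-pres ψ (to φ x)) (label-pres φ x)
  ; edge-pres  = λ x y → trans (edge-pres ψ (to φ x) (to φ y)) (edge-pres φ x y)
  }

≅⇒≃ : ∀ {G H} → G ≅ H → ⟦ G ⟧ ≃ ⟦ H ⟧
≅⇒≃ φ = record
  { vertices   = mk↔ₛ′ (_≅_.to φ) (_≅_.from φ) (_≅_.to-from φ) (_≅_.from-to φ)
  ; label-pres = _≅_.lab-pres φ
  ; edge-pres  = _≅_.E-pres φ
  }

≃⇒≅ : ∀ {G H} → ⟦ G ⟧ ≃ ⟦ H ⟧ → G ≅ H
≃⇒≅ φ = record
  { to       = to φ               ; from    = from φ
  ; to-from  = strictlyInverseˡ φ ; from-to = strictlyInverseʳ φ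
  ; lab-pres = label-pres φ       ; E-pres  = edge-pres φ
  }

≅-refl : ∀ {G} → G ≅ G
≅-refl = ≃⇒≅ ≃-refl

≅-sym : ∀ {G H} → G ≅ H → H ≅ G
≅-sym φ = ≃⇒≅ (≃-sym (≅⇒≃ φ))

≅-trans : ∀ {G H K} → G ≅ H → H ≅ K → G ≅ K
≅-trans φ ψ = ≃⇒≅ (≃-trans (≅⇒≃ φ) (≅⇒≃ ψ))

Glue : (X Y : LGraph) → (Vertex X → Vertex Y → Bool) → LGraph
Glue X Y cross = record
  { Vertex = Vertex X ⊎ Vertex Y
  ; label  = λ { (inj₁ x) → label X x ; (inj₂ y) → label Y y }
  ; edge   = λ { (inj₁ x) (inj₁ x′) → edge X x x′ ; (inj₂ y) (inj₂ y′) → edge Y y y′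
               ; (inj₁ x) (inj₂ y)  → cross x y   ; (inj₂ y) (inj₁ x)  → cross x y }
  }

infixr 7 _⊗′_
_⊗′_ : LGraph → LGraph → LGraph
X ⊗′ Y = Glue X Y (λ _ _ → true)

infixr 6 _⊔′_
_⊔′_ : LGraph → LGraph → LGraph
X ⊔′ Y = Glue X Y (λ _ _ → false)

hole : ∀ {n} {Z : Set} → Subset n → Fin n → Z → Bool
hole R c _ = lookup R c

⟦glue⟧ : ∀ G H cross → ⟦ glue G H cross ⟧ ≃ Glue ⟦ G ⟧ ⟦ H ⟧ cross
⟦glue⟧ G H cross = record
  { vertices   = +↔⊎
  ; label-pres = λ u → label-split (splitAt (size G) u)
  ; edge-pres  = λ u v → edge-split (splitAt (size G) u) (splitAt (size G) v)
  }
  where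
  label-split : ∀ s → label (Glue ⟦ G ⟧ ⟦ H ⟧ cross) s ≡ sumLab (lab G) (lab H) s
  label-split (inj₁ _) = refl
  label-split (inj₂ _) = refl
  edge-split : ∀ s t → edge (Glue ⟦ G ⟧ ⟦ H ⟧ cross) s t ≡ sumE (E G) (E H) cross s t
  edge-split (inj₁ _) (inj₁ _) = refl
  edge-split (inj₁ _) (inj₂ _) = refl
  edge-split (inj₂ _) (inj₁ _) = refl
  edge-split (inj₂ _) (inj₂ _) = refl

Glue-cong : ∀ {X X′ Y Y′ cross cross′} (φ : X ≃ X′) (ψ : Y ≃ Y′) →
            (∀ x y → cross′ (to φ x) (to ψ y) ≡ cross x y) →
            Glue X Y cross ≃ Glue X′ Y′ cross′
Glue-cong φ ψ cross-pres = record
  { vertices   = ⊎-cong (vertices φ) (vertices ψ)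
  ; label-pres = λ { (inj₁ x) → label-pres φ x ; (inj₂ y) → label-pres ψ y }
  ; edge-pres  = λ { (inj₁ x) (inj₁ x′) → edge-pres φ x x′ ; (inj₂ y) (inj₂ y′) → edge-pres ψ y y′
                   ; (inj₁ x) (inj₂ y)  → cross-pres x y   ; (inj₂ y) (inj₁ x)  → cross-pres x y }
  }

⊗′-comm : ∀ {X Y} → X ⊗′ Y ≃ Y ⊗′ X
⊗′-comm = record
  { vertices   = ⊎-comm _ _
  ; label-pres = λ { (inj₁ _) → refl ; (inj₂ _) → refl }
  ; edge-pres  = λ { (inj₁ _) (inj₁ _) → refl ; (inj₂ _) (inj₂ _) → refl
                   ; (inj₁ _) (inj₂ _) → refl ; (inj₂ _) (inj₁ _) → refl }
  }

Glue-⊗′-context : ∀ {C₁ C₂ X} (h : Vertex C₁ ⊎ Vertex C₂ → Vertex X → Bool) →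
                  (∀ c₂ x → h (inj₂ c₂) x ≡ true) →
                  Glue (C₁ ⊗′ C₂) X h ≃ Glue C₁ X (λ c₁ → h (inj₁ c₁)) ⊗′ C₂
Glue-⊗′-context h h⊇C₂ = record
  { vertices   = ↔-trans (⊎-assoc 0ℓ _ _ _)
                   (↔-trans (⊎-cong ↔-refl (⊎-comm _ _)) (↔-sym (⊎-assoc 0ℓ _ _ _)))
  ; label-pres = λ { (inj₁ (inj₁ _)) → refl ; (inj₁ (inj₂ _)) → refl ; (inj₂ _) → refl }
  ; edge-pres  = λ where
      (inj₁ (inj₁ _))  (inj₁ (inj₁ _))  → refl
      (inj₁ (inj₁ _))  (inj₁ (inj₂ _))  → refl
      (inj₁ (inj₁ _))  (inj₂ _)         → refl
      (inj₁ (inj₂ _))  (inj₁ (inj₁ _))  → refl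
      (inj₁ (inj₂ _))  (inj₁ (inj₂ _))  → refl
      (inj₁ (inj₂ c₂)) (inj₂ x)         → sym (h⊇C₂ c₂ x)
      (inj₂ _)         (inj₁ (inj₁ _))  → refl
      (inj₂ x)         (inj₁ (inj₂ c₂)) → sym (h⊇C₂ c₂ x)
      (inj₂ _)         (inj₂ _)         → refl
  }

isLeft : {A B : Set} → A ⊎ B → Bool
isLeft (inj₁ _) = true
isLeft (inj₂ _) = false

swap-isLeft : ∀ {A B : Set} (u : A ⊎ B) → T (not (isLeft u)) → T (isLeft (swap u))
swap-isLeft (inj₂ _) _ = tt

⊗′-across : ∀ {X Y} {u v : Vertex (X ⊗′ Y)} → T (isLeft u) → T (not (isLeft v)) →
            edge (X ⊗′ Y) u v ≡ true
⊗′-across {u = inj₁ _} {inj₂ _} _ _ = refl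

⊗′-nonadjacent-same-side : ∀ {X Y} (u v : Vertex (X ⊗′ Y)) → edge (X ⊗′ Y) u v ≡ false →
                           isLeft u ≡ isLeft v
⊗′-nonadjacent-same-side (inj₁ _) (inj₁ _) _ = refl
⊗′-nonadjacent-same-side (inj₂ _) (inj₂ _) _ = refl

Res : (X : LGraph) → (Vertex X → Bool) → LGraph
Res X p = record
  { Vertex = Σ (Vertex X) (λ x → T (p x))
  ; label  = λ (x , _) → label X x
  ; edge   = λ (x , _) (y , _) → edge X x y
  }

Σ-T-≡ : ∀ {A : Set} {p : A → Bool} {a a′ : A} {t : T (p a)} {t′ : T (p a′)} →
        a ≡ a′ → _≡_ {A = Σ A (λ x → T (p x))} (a , t) (a′ , t′)
Σ-T-≡ {a = a} refl = cong (a ,_) (T-irrelevant _ _)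

Res-transport : ∀ {X Y} (φ : X ≃ Y) (p : Vertex Y → Bool) → Res X (λ x → p (to φ x)) ≃ Res Y p
Res-transport φ p = record
  { vertices   = mk↔ₛ′ (λ (x , t) → to φ x , t)
                       (λ (y , t) → from φ y , subst (λ y′ → T (p y′)) (sym (strictlyInverseˡ φ y)) t)
                       (λ (y , _) → Σ-T-≡ (strictlyInverseˡ φ y))
                       (λ (x , _) → Σ-T-≡ (strictlyInverseʳ φ x))
  ; label-pres = λ (x , _) → label-pres φ x
  ; edge-pres  = λ (x , _) (y , _) → edge-pres φ x y
  }

Res-isLeft : ∀ {X Y cross} → Res (Glue X Y cross) isLeft ≃ X
Res-isLeft = record
  { vertices   = mk↔ₛ′ (λ { (inj₁ x , _) → x ; (inj₂ _ , ()) }) (λ x → inj₁ x , tt)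
                       (λ _ → refl) (λ { (inj₁ _ , _) → refl ; (inj₂ _ , ()) })
  ; label-pres = λ { (inj₁ _ , _) → refl ; (inj₂ _ , ()) }
  ; edge-pres  = λ { (inj₁ _ , _) (inj₁ _ , _) → refl ; (inj₁ _ , _) (inj₂ _ , ()) ; (inj₂ _ , ()) _ }
  }

Res-isRight : ∀ {X Y cross} → Res (Glue X Y cross) (λ v → not (isLeft v)) ≃ Y
Res-isRight = record
  { vertices   = mk↔ₛ′ (λ { (inj₂ y , _) → y ; (inj₁ _ , ()) }) (λ y → inj₂ y , tt)
                       (λ _ → refl) (λ { (inj₂ _ , _) → refl ; (inj₁ _ , ()) })
  ; label-pres = λ { (inj₂ _ , _) → refl ; (inj₁ _ , ()) }
  ; edge-pres  = λ { (inj₂ _ , _) (inj₂ _ , _) → refl ; (inj₂ _ , _) (inj₁ _ , ()) ; (inj₁ _ , ()) _ }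
  }

T-not-T : ∀ {b} → T b → T (not b) → ⊥
T-not-T {true} _ ()

module _ {X Y : LGraph} {cross : Vertex X → Vertex Y → Bool} (p : Vertex X ⊎ Vertex Y → Bool)
         (p⊇Y : ∀ y → T (p (inj₂ y))) where

  Res-Glue-keep-right :
    Res (Glue X Y cross) p ≃ Glue (Res X (λ x → p (inj₁ x))) Y (λ (x , _) → cross x)
  Res-Glue-keep-right = record
    { vertices   = mk↔ₛ′ (λ { (inj₁ x , t) → inj₁ (x , t) ; (inj₂ y , _) → inj₂ y })
                         (λ { (inj₁ (x , t)) → inj₁ x , t ; (inj₂ y) → inj₂ y , p⊇Y y })
                         (λ { (inj₁ _) → refl ; (inj₂ _) → refl })
                         (λ { (inj₁ _ , _) → refl ; (inj₂ _ , _) → Σ-T-≡ refl })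
    ; label-pres = λ { (inj₁ _ , _) → refl ; (inj₂ _ , _) → refl }
    ; edge-pres  = λ { (inj₁ _ , _) (inj₁ _ , _) → refl ; (inj₁ _ , _) (inj₂ _ , _) → refl
                     ; (inj₂ _ , _) (inj₁ _ , _) → refl ; (inj₂ _ , _) (inj₂ _ , _) → refl }
    }

  Res-Glue-drop-right : Res (Glue X Y cross) (λ v → not (p v)) ≃ Res X (λ x → not (p (inj₁ x)))
  Res-Glue-drop-right = record
    { vertices   = mk↔ₛ′ (λ { (inj₁ x , t) → x , t ; (inj₂ y , t) → ⊥-elim (T-not-T (p⊇Y y) t) })
                         (λ (x , t) → inj₁ x , t)
                         (λ _ → refl)
                         (λ { (inj₁ _ , _) → refl ; (inj₂ y , t) → ⊥-elim (T-not-T (p⊇Y y) t) })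
    ; label-pres = λ { (inj₁ _ , _) → refl ; (inj₂ y , t) → ⊥-elim (T-not-T (p⊇Y y) t) }
    ; edge-pres  = λ { (inj₁ _ , _) (inj₁ _ , _) → refl
                     ; (inj₁ _ , _) (inj₂ y , t) → ⊥-elim (T-not-T (p⊇Y y) t)
                     ; (inj₂ y , t) _ → ⊥-elim (T-not-T (p⊇Y y) t) }
    }

T-or-T-not : ∀ b → T b ⊎ T (not b)
T-or-T-not true  = inj₁ tt
T-or-T-not false = inj₂ tt

T-or-T-not≡inj₁ : ∀ {b} (t : T b) → T-or-T-not b ≡ inj₁ t
T-or-T-not≡inj₁ {true} _ = refl

T-or-T-not≡inj₂ : ∀ {b} (t : T (not b)) → T-or-T-not b ≡ inj₂ t
T-or-T-not≡inj₂ {false} _ = refl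

colour-classes-⊗′ : ∀ {X} (q : Vertex X → Bool) → (∀ x y → edge X x y ≡ edge X y x) →
                    (∀ x y → T (q x) → T (not (q y)) → edge X x y ≡ true) →
                    X ≃ Res X q ⊗′ Res X (λ x → not (q x))
colour-classes-⊗′ {X} q edge-sym across = ≃-sym (record
  { vertices   = mk↔ₛ′ forget classify
                       (λ x → forget-map x (T-or-T-not (q x)))
                       (λ { (inj₁ (x , t)) → cong (map (x ,_) (x ,_)) (T-or-T-not≡inj₁ t)
                          ; (inj₂ (x , t)) → cong (map (x ,_) (x ,_)) (T-or-T-not≡inj₂ t) })
  ; label-pres = λ { (inj₁ _) → refl ; (inj₂ _) → refl }
  ; edge-pres  = λ { (inj₁ _) (inj₁ _) → refl ; (inj₂ _) (inj₂ _) → refl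
                   ; (inj₁ (x , t)) (inj₂ (y , t′)) → across x y t t′
                   ; (inj₂ (y , t′)) (inj₁ (x , t)) → trans (edge-sym y x) (across x y t t′) }
  })
  where
  forget : Vertex (Res X q ⊗′ Res X (λ x → not (q x))) → Vertex X
  forget (inj₁ (x , _)) = x
  forget (inj₂ (x , _)) = x
  classify : Vertex X → Vertex (Res X q ⊗′ Res X (λ x → not (q x)))
  classify x = map (x ,_) (x ,_) (T-or-T-not (q x))
  forget-map : ∀ x s → forget (map (x ,_) (x ,_) s) ≡ x
  forget-map x (inj₁ _) = refl
  forget-map x (inj₂ _) = refl

#T : Bool → ℕ
#T true  = 1
#T false = 0

Fin-#T↔T : ∀ b → Fin (#T b) ↔ T b
Fin-#T↔T true  = 1↔⊤
Fin-#T↔T false = 0↔⊥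

#true : ∀ {n} → (Fin n → Bool) → ℕ
#true {zero}  p = 0
#true {suc n} p = #T (p zero) + #true (λ i → p (suc i))

Σ-Fin-suc↔ : ∀ {n} (p : Fin (suc n) → Bool) →
             (T (p zero) ⊎ Σ (Fin n) (λ i → T (p (suc i)))) ↔ Σ (Fin (suc n)) (λ i → T (p i))
Σ-Fin-suc↔ p = mk↔ₛ′ (λ { (inj₁ t) → zero , t ; (inj₂ (i , t)) → suc i , t })
                     (λ { (zero , t) → inj₁ t ; (suc i , t) → inj₂ (i , t) })
                     (λ { (zero , _) → refl ; (suc _ , _) → refl })
                     (λ { (inj₁ _) → refl ; (inj₂ _) → refl })

Fin-#true↔ : ∀ {n} (p : Fin n → Bool) → Fin (#true p) ↔ Σ (Fin n) (λ i → T (p i))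
Fin-#true↔ {zero}  p = mk↔ₛ′ (λ ()) (λ ()) (λ ()) (λ ())
Fin-#true↔ {suc n} p =
  ↔-trans +↔⊎ (↔-trans (⊎-cong (Fin-#T↔T (p zero)) (Fin-#true↔ (λ i → p (suc i)))) (Σ-Fin-suc↔ p))

restrict : (G : Graph) → (Fin (size G) → Bool) → Graph
restrict G p = record
  { size  = #true p
  ; lab   = λ a → lab G (vertex a)
  ; E     = λ a b → E G (vertex a) (vertex b)
  ; E-sym = λ a b → E-sym G (vertex a) (vertex b)
  ; E-irr = λ a → E-irr G (vertex a)
  }
  where
  vertex : Fin (#true p) → Fin (size G)
  vertex a = proj₁ (Inverse.to (Fin-#true↔ p) a)

⟦restrict⟧ : ∀ G p → ⟦ restrict G p ⟧ ≃ Res ⟦ G ⟧ p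
⟦restrict⟧ G p = record
  { vertices = Fin-#true↔ p ; label-pres = λ _ → refl ; edge-pres = λ _ _ → refl }

-- Co-connectedness of rule conclusions

Connected : (V : Set) → (V → V → Set) → Set
Connected V R = (c : V → Bool) → (∀ x y → R x y → c x ≡ c y) → ∀ x y → c x ≡ c y

Coconnected : LGraph → Set
Coconnected X = Connected (Vertex X) (λ x y → edge X x y ≡ false)

Adjacent : (G : Graph) → Fin (size G) → Fin (size G) → Set
Adjacent G i j = E G i j ≡ true

Coconnected-≃ : ∀ {X Y} → X ≃ Y → Coconnected X → Coconnected Y
Coconnected-≃ {X} φ coconnected c c-resp y y′ = begin
  c y                   ≡⟨ cong c (strictlyInverseˡ φ y) ⟨
  c (to φ (from φ y))   ≡⟨ coconnected (λ x → c (to φ x)) c∘to-resp (from φ y) (from φ y′) ⟩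
  c (to φ (from φ y′))  ≡⟨ cong c (strictlyInverseˡ φ y′) ⟩
  c y′                  ∎
  where
  open ≡-Reasoning
  c∘to-resp : ∀ x x′ → edge X x x′ ≡ false → c (to φ x) ≡ c (to φ x′)
  c∘to-resp x x′ nonadjacent = c-resp (to φ x) (to φ x′) (trans (edge-pres φ x x′) nonadjacent)

⊔′-coconnected : ∀ {X Y} → Vertex X → Vertex Y → Coconnected (X ⊔′ Y)
⊔′-coconnected x₀ y₀ c c-resp = λ where
    (inj₁ x) (inj₁ x′) → trans (across x y₀) (sym (across x′ y₀))
    (inj₁ x) (inj₂ y)  → across x y
    (inj₂ y) (inj₁ x)  → sym (across x y)
    (inj₂ y) (inj₂ y′) → trans (sym (across x₀ y)) (across x₀ y′)
  where
  across : ∀ x y → c (inj₁ x) ≡ c (inj₂ y)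
  across x y = c-resp (inj₁ x) (inj₂ y) refl

⊔′-coconnected-left : ∀ {X Y} → Coconnected X → Vertex X → Coconnected (X ⊔′ Y)
⊔′-coconnected-left coconnected x₀ c c-resp = λ where
    (inj₁ x) (inj₁ x′) → coconnected (λ x → c (inj₁ x)) (λ x x′ → c-resp (inj₁ x) (inj₁ x′)) x x′
    (inj₁ x) (inj₂ y)  → across x y
    (inj₂ y) (inj₁ x)  → sym (across x y)
    (inj₂ y) (inj₂ y′) → trans (sym (across x₀ y)) (across x₀ y′)
  where
  across : ∀ x y → c (inj₁ x) ≡ c (inj₂ y)
  across x y = c-resp (inj₁ x) (inj₂ y) refl

tabulate-∈ : ∀ {n} {c : Fin n → Bool} {x} → c x ≡ true → x ∈ tabulate c
tabulate-∈ {c = c} {x} cx≡true = lookup⇒[]= x (tabulate c) (trans (lookup∘tabulate c x) cx≡true)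

∈-tabulate : ∀ {n} {c : Fin n → Bool} {x} → x ∈ tabulate c → c x ≡ true
∈-tabulate {c = c} {x} x∈ = trans (sym (lookup∘tabulate c x)) ([]=⇒lookup x∈)

∉-tabulate : ∀ {n} {c : Fin n → Bool} {x} → c x ≡ false → x ∉ tabulate c
∉-tabulate cx≡false x∈ = not-¬ cx≡false (∈-tabulate x∈)

separated⇒module : ∀ G (S : Subset (size G)) → (∀ {x y} → x ∈ S → y ∉ S → E G x y ≡ false) →
                   IsModule G S
separated⇒module G S separated v v∉S = inj₂ λ u u∈S → trans (E-sym G v u) (separated u∈S v∉S)

∁-separated : ∀ G (S : Subset (size G)) → (∀ {x y} → x ∈ S → y ∉ S → E G x y ≡ false) →
              ∀ {x y} → x ∈ ∁ S → y ∉ ∁ S → E G x y ≡ false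
∁-separated G S separated x∈∁S y∉∁S =
  trans (E-sym G _ _) (separated (x∉∁p⇒x∈p y∉∁S) (x∈∁p⇒x∉p x∈∁S))

pred-∉-0-1-n : ∀ {n} → 3 ≤ n → n ∸ 1 ≡ 0 ⊎ n ∸ 1 ≡ 1 ⊎ n ∸ 1 ≡ n → ⊥
pred-∉-0-1-n (s≤s (s≤s (s≤s _))) (inj₂ (inj₁ ()))
pred-∉-0-1-n (s≤s (s≤s (s≤s _))) (inj₂ (inj₂ e)) = <-irrefl e (n<1+n _)

module _ {P : Graph} (prime : Prime P) (3≤n : 3 ≤ size P) where
  private
    n = size P

  -- S and ∁ S are both modules, so each has size 0, 1 or n; for n ≥ 3 that forces S = ∅ or S = V_P.
  prime-inseparable : ∀ (S : Subset n) → (∀ {x y} → x ∈ S → y ∉ S → E P x y ≡ false) →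
                      ∀ {x y} → x ∈ S → y ∉ S → ⊥
  prime-inseparable S separated {x} {y} x∈S y∉S
    with proj₂ prime S (separated⇒module P S separated)
  ... | inj₁ ∣S∣≡0 =
    x∈p⇒x∉∁p x∈S (subst (x ∈_) (sym (∣p∣≡n⇒p≡⊤ (trans (∣∁p∣≡n∸∣p∣ S) (cong (n ∸_) ∣S∣≡0)))) ∈⊤)
  ... | inj₂ (inj₂ ∣S∣≡n) = y∉S (subst (y ∈_) (sym (∣p∣≡n⇒p≡⊤ ∣S∣≡n)) ∈⊤)
  ... | inj₂ (inj₁ ∣S∣≡1) = pred-∉-0-1-n 3≤n
          (subst (λ k → k ≡ 0 ⊎ k ≡ 1 ⊎ k ≡ n) (trans (∣∁p∣≡n∸∣p∣ S) (cong (n ∸_) ∣S∣≡1))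
            (proj₂ prime (∁ S) (separated⇒module P (∁ S) (∁-separated P S separated))))

  private
    no-bicolouring : (c : Fin n → Bool) → (∀ x y → Adjacent P x y → c x ≡ c y) →
                     ∀ {x y} → c x ≡ true → c y ≡ false → ⊥
    no-bicolouring c c-resp cx cy =
      prime-inseparable (tabulate c) separated (tabulate-∈ cx) (∉-tabulate cy)
      where
      separated : ∀ {u v} → u ∈ tabulate c → v ∉ tabulate c → E P u v ≡ false
      separated u∈ v∉ = ¬-not λ adj → v∉ (tabulate-∈ (trans (sym (c-resp _ _ adj)) (∈-tabulate u∈)))

  prime⇒connected : Connected (Fin n) (Adjacent P)
  prime⇒connected c c-resp x y with c x in cx | c y in cy
  ... | true  | true  = refl
  ... | false | false = refl
  ... | true  | false = ⊥-elim (no-bicolouring c c-resp cx cy)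
  ... | false | true  = ⊥-elim (no-bicolouring (λ z → not (c z))
                                  (λ u v adj → cong not (c-resp u v adj)) (cong not cx) (cong not cy))

other-vertex : ∀ {n} → 2 ≤ n → (i : Fin n) → ∃ λ j → ¬ j ≡ i
other-vertex (s≤s (s≤s _)) i = punchIn i zero , punchInᵢ≢i i zero

-- An isolated vertex i would make the colouring "is i" respect all edges.
connected⇒neighbour : ∀ {P} → Connected (Fin (size P)) (Adjacent P) → 2 ≤ size P →
                      ∀ i → ∃ (Adjacent P i)
connected⇒neighbour {P} connected 2≤n i with any? (λ j → E P i j ≟ᵇ true)
... | yes neighbour = neighbour
... | no  isolated  = ⊥-elim (not-¬ (dec-false (j ≟ i) j≢i)
                               (trans (sym (connected is-i is-i-resp i j)) (dec-true (i ≟ i) refl)))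
  where
  j : Fin (size P)
  j = proj₁ (other-vertex 2≤n i)
  j≢i : ¬ j ≡ i
  j≢i = proj₂ (other-vertex 2≤n i)
  is-i : Fin (size P) → Bool
  is-i k = does (k ≟ i)
  is-i-resp : ∀ u v → Adjacent P u v → is-i u ≡ is-i v
  is-i-resp u v adj with u ≟ i | v ≟ i
  ... | yes refl | _        = ⊥-elim (isolated (v , adj))
  ... | no _     | yes refl = ⊥-elim (isolated (u , trans (E-sym P i u) adj))
  ... | no _     | no _     = refl

encode : ∀ {n} (f : Fin n → ℕ) → Σ (Fin n) (λ i → Fin (f i)) → Fin (sumF f)
encode {suc n} f (zero  , a) = a ↑ˡ sumF (λ i → f (suc i))
encode {suc n} f (suc i , a) = f zero ↑ʳ encode (λ i → f (suc i)) (i , a)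

decode-encode : ∀ {n} (f : Fin n → ℕ) x → decode f (encode f x) ≡ x
decode-encode {suc n} f (zero , a) rewrite splitAt-↑ˡ (f zero) a (sumF (λ i → f (suc i))) = refl
decode-encode {suc n} f (suc i , a)
  rewrite splitAt-↑ʳ (f zero) (sumF (λ i → f (suc i))) (encode (λ i → f (suc i)) (i , a))
        | decode-encode (λ i → f (suc i)) (i , a) = refl

‾-compo-nonadjacent : ∀ {P} (M : Fin (size P) → Graph) {i j} a b → Adjacent P i j →
                      compoE (compE (E P)) M (i , a) (j , b) ≡ false
‾-compo-nonadjacent {P} M {i} {j} a b adj with i ≟ j
... | yes refl = ⊥-elim (not-¬ (E-irr P i) adj)
-- the second `with` abstracts the comparison i ≟ j made inside compE
... | no  i≢j with i ≟ j
...   | yes i≡j = ⊥-elim (i≢j i≡j)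
...   | no  _   = cong not adj

-- Vertices in P-adjacent blocks are non-adjacent, so a colouring respecting non-edges is
-- constant on each block (every block has a P-neighbour) and the block colours respect P's edges.
‾⟨⟩-coconnected : ∀ {P} → Connected (Fin (size P)) (Adjacent P) → 2 ≤ size P →
                  (M : Fin (size P) → Graph) → (∀ i → 1 ≤ size (M i)) →
                  Coconnected ⟦ (‾ P) ⟨ M ⟩ ⟧
‾⟨⟩-coconnected {P} connected 2≤n M M≢∅ q q-resp u v = begin
  q u                ≡⟨ q≡colour u ⟩
  colour (block u)   ≡⟨ connected colour colour-resp (block u) (block v) ⟩
  colour (block v)   ≡⟨ q≡colour v ⟨
  q v                ∎
  where
  open ≡-Reasoning
  sizes : Fin (size P) → ℕ
  sizes i = size (M i)
  block : Fin (sumF sizes) → Fin (size P)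
  block w = proj₁ (decode sizes w)
  representative : Fin (size P) → Fin (sumF sizes)
  representative i = encode sizes (i , fromℕ< (M≢∅ i))
  block-representative : ∀ i → block (representative i) ≡ i
  block-representative i = cong proj₁ (decode-encode sizes (i , fromℕ< (M≢∅ i)))
  colour : Fin (size P) → Bool
  colour i = q (representative i)
  q≡colour-adjacent : ∀ w j → Adjacent P (block w) j → q w ≡ colour j
  q≡colour-adjacent w j adj = q-resp w (representative j)
    (‾-compo-nonadjacent {P} M (proj₂ (decode sizes w)) (proj₂ (decode sizes (representative j)))
      (subst (Adjacent P (block w)) (sym (block-representative j)) adj))
  colour-resp : ∀ i j → Adjacent P i j → colour i ≡ colour j
  colour-resp i j adj = q≡colour-adjacent (representative i) j
    (subst (λ k → Adjacent P k j) (sym (block-representative i)) adj)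
  q≡colour : ∀ w → q w ≡ colour (block w)
  q≡colour w = let (j , adj) = connected⇒neighbour {P} connected 2≤n (block w) in
    trans (q≡colour-adjacent w j adj) (sym (colour-resp (block w) j adj))

⟦⊔⟧-coconnected : ∀ G H → Coconnected (⟦ G ⟧ ⊔′ ⟦ H ⟧) → Fin (size G) →
                  Coconnected ⟦ G ⊔ H ⟧ × Fin (size (G ⊔ H))
⟦⊔⟧-coconnected G H coconnected x = Coconnected-≃ (≃-sym (⟦glue⟧ G H _)) coconnected , x ↑ˡ size H

rule-conclusion-coconnected : ∀ {X Y} → Rule X Y → Coconnected ⟦ Y ⟧ × Fin (size Y)
rule-conclusion-coconnected (ai↓ a) =
  ⟦⊔⟧-coconnected (atom (dual a)) (atom a) (⊔′-coconnected zero zero) zero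
rule-conclusion-coconnected (ss↓ B A S (x , _) 1≤∣A∣) =
  ⟦⊔⟧-coconnected B A (⊔′-coconnected x (fromℕ< 1≤∣A∣)) x
rule-conclusion-coconnected (p↓ P prime 4≤n M N M≢∅) =
  ⟦⊔⟧-coconnected ((‾ P) ⟨ M ⟩) (P ⟨ N ⟩)
    (⊔′-coconnected-left (‾⟨⟩-coconnected {P} (prime⇒connected {P} prime 3≤n) 2≤n M M≢∅) v) v
  where
  3≤n : 3 ≤ size P
  3≤n = ≤-trans (n≤1+n 3) 4≤n
  2≤n : 2 ≤ size P
  2≤n = ≤-trans (n≤1+n 2) 3≤n
  i : Fin (size P)
  i = fromℕ< (≤-trans (n≤1+n 1) 2≤n)
  v : Fin (size ((‾ P) ⟨ M ⟩))
  v = encode (λ j → size (M j)) (i , fromℕ< (M≢∅ i))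

-- Splitting derivations of a tensor

coconnected-on-one-side : ∀ {Y X₁ X₂} (f : Vertex Y → Vertex (X₁ ⊗′ X₂)) →
                          (∀ y y′ → edge (X₁ ⊗′ X₂) (f y) (f y′) ≡ edge Y y y′) →
                          Coconnected Y → Vertex Y →
                          (∀ y → T (isLeft (f y))) ⊎ (∀ y → T (not (isLeft (f y))))
coconnected-on-one-side f f-edge coconnected y₀ = on-side (isLeft (f y₀)) (same-side y₀)
  where
  same-side : ∀ y y′ → isLeft (f y) ≡ isLeft (f y′)
  same-side = coconnected (λ y → isLeft (f y)) λ y y′ nonadjacent →
    ⊗′-nonadjacent-same-side (f y) (f y′) (trans (f-edge y y′) nonadjacent)
  on-side : ∀ b → (∀ y → b ≡ isLeft (f y)) →
            (∀ y → T (isLeft (f y))) ⊎ (∀ y → T (not (isLeft (f y))))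
  on-side true  side≡ = inj₁ λ y → subst T (side≡ y) tt
  on-side false side≡ = inj₂ λ y → subst (λ b → T (not b)) (side≡ y) tt

record ContextSplitting (C : Graph) (R : Subset (size C)) (Y A B : Graph) : Set where
  field
    C₁ C₂ : Graph
    R₁    : Subset (size C₁)
    A≅    : A ≅ C₁ [ Y ]⟨ R₁ ⟩
    B≅    : B ≅ C₂
    plug  : ∀ X → C [ X ]⟨ R ⟩ ≅ C₁ [ X ]⟨ R₁ ⟩ ⊗ C₂

-- The vertices of C lying in B are joined to everything in A, including y₀ ∈ Y, so they all
-- lie in R: C splits into its colour classes C₁ ⊗ C₂ with C₂ ≅ B.
split-context : ∀ {C R Y A B} (ψ : Glue ⟦ C ⟧ ⟦ Y ⟧ (hole R) ≃ ⟦ A ⟧ ⊗′ ⟦ B ⟧) →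
                (∀ y → T (isLeft (to ψ (inj₂ y)))) → Fin (size Y) → ContextSplitting C R Y A B
split-context {C} {R} {Y} {A} {B} ψ Y⊆A y₀ = record
  { C₁ = C₁ ; C₂ = C₂ ; R₁ = R₁ ; A≅ = ≃⇒≅ A≃ ; B≅ = ≃⇒≅ B≃ ; plug = λ X → ≃⇒≅ (plug≃ X) }
  where
  inA : Fin (size C) → Bool
  inA c = isLeft (to ψ (inj₁ c))
  C₁ C₂ : Graph
  C₁ = restrict C inA
  C₂ = restrict C (λ c → not (inA c))
  R₁ : Subset (size C₁)
  R₁ = tabulate (λ k → lookup R (proj₁ (to (⟦restrict⟧ C inA) k)))

  C₁-plug : ∀ Z → Glue (Res ⟦ C ⟧ inA) ⟦ Z ⟧ (λ (c , _) → hole R c) ≃ ⟦ C₁ [ Z ]⟨ R₁ ⟩ ⟧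
  C₁-plug Z = ≃-trans (Glue-cong (≃-sym (⟦restrict⟧ C inA)) ≃-refl R₁-pres) (≃-sym (⟦glue⟧ C₁ Z _))
    where
    R₁-pres : ∀ a z → hole R₁ (from (⟦restrict⟧ C inA) a) z ≡ lookup R (proj₁ a)
    R₁-pres a _ = trans (lookup∘tabulate _ (from (⟦restrict⟧ C inA) a))
                        (cong (λ a′ → lookup R (proj₁ a′)) (strictlyInverseˡ (⟦restrict⟧ C inA) a))

  A≃ : ⟦ A ⟧ ≃ ⟦ C₁ [ Y ]⟨ R₁ ⟩ ⟧
  A≃ = ≃-trans (≃-sym Res-isLeft)
      (≃-trans (≃-sym (Res-transport ψ isLeft))
      (≃-trans (Res-Glue-keep-right (λ v → isLeft (to ψ v)) Y⊆A)
               (C₁-plug Y)))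

  B≃ : ⟦ B ⟧ ≃ ⟦ C₂ ⟧
  B≃ = ≃-trans (≃-sym Res-isRight)
      (≃-trans (≃-sym (Res-transport ψ (λ v → not (isLeft v))))
      (≃-trans (Res-Glue-drop-right (λ v → isLeft (to ψ v)) Y⊆A)
               (≃-sym (⟦restrict⟧ C _))))

  across : ∀ c c′ → T (inA c) → T (not (inA c′)) → E C c c′ ≡ true
  across c c′ t t′ = trans (sym (edge-pres ψ (inj₁ c) (inj₁ c′))) (⊗′-across t t′)

  R⊇C₂ : ∀ c → T (not (inA c)) → lookup R c ≡ true
  R⊇C₂ c t = trans (sym (edge-pres ψ (inj₂ y₀) (inj₁ c))) (⊗′-across (Y⊆A y₀) t)

  C≃ : ⟦ C ⟧ ≃ Res ⟦ C ⟧ inA ⊗′ Res ⟦ C ⟧ (λ c → not (inA c))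
  C≃ = colour-classes-⊗′ inA (E-sym C) across

  plug≃ : ∀ X → ⟦ C [ X ]⟨ R ⟩ ⟧ ≃ ⟦ C₁ [ X ]⟨ R₁ ⟩ ⊗ C₂ ⟧
  plug≃ X = ≃-trans (⟦glue⟧ C X _)
           (≃-trans (Glue-cong C≃ ≃-refl (λ c _ → cong (lookup R) (strictlyInverseʳ C≃ c)))
           (≃-trans (Glue-⊗′-context (λ s → hole R (from C≃ s)) (λ (c , t) _ → R⊇C₂ c t))
           (≃-trans (Glue-cong (C₁-plug X) (≃-sym (⟦restrict⟧ C _)) (λ _ _ → refl))
                    (≃-sym (⟦glue⟧ (C₁ [ X ]⟨ R₁ ⟩) C₂ _)))))

Splits : Graph → Set
Splits G = ∀ A B → G ≅ A ⊗ B → ⊢GS A × ⊢GS B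

∅≅ : ∀ {G} → (Fin (size G) → Fin 0) → ∅ ≅ G
∅≅ f = record
  { to       = λ ()                          ; from    = λ v → ⊥-elim (¬Fin0 (f v))
  ; to-from  = λ v → ⊥-elim (¬Fin0 (f v))    ; from-to = λ ()
  ; lab-pres = λ ()                          ; E-pres  = λ ()
  }

∅-splits : Splits ∅
∅-splits A B φ = iso (∅≅ λ a → _≅_.from φ (a ↑ˡ size B)) ◅ ε
               , iso (∅≅ λ b → _≅_.from φ (size A ↑ʳ b)) ◅ ε

rule-splits : ∀ {G′ G C R X Y} → Splits G′ → Rule X Y → G′ ≅ C [ X ]⟨ R ⟩ → G ≅ C [ Y ]⟨ R ⟩ →
              Splits G
rule-splits {C = C} {R} {X} {Y} splits′ ρ g h A B φ =
  [ (λ Y⊆A → derive (split-context ψ Y⊆A y₀))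
  , (λ Y⊆B → ×-swap (derive (split-context (≃-trans ψ ⊗′-comm) (λ y → swap-isLeft _ (Y⊆B y)) y₀)))
  ]′ (coconnected-on-one-side {⟦ Y ⟧} {⟦ A ⟧} {⟦ B ⟧} (λ y → to ψ (inj₂ y))
        (λ y y′ → edge-pres ψ (inj₂ y) (inj₂ y′)) (proj₁ (rule-conclusion-coconnected ρ)) y₀)
  where
  ψ : Glue ⟦ C ⟧ ⟦ Y ⟧ (hole R) ≃ ⟦ A ⟧ ⊗′ ⟦ B ⟧
  ψ = ≃-trans (≃-sym (⟦glue⟧ C Y _)) (≃-trans (≅⇒≃ (≅-trans (≅-sym h) φ)) (⟦glue⟧ A B _))
  y₀ : Fin (size Y)
  y₀ = proj₂ (rule-conclusion-coconnected ρ)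
  derive : ∀ {A B} → ContextSplitting C R Y A B → ⊢GS A × ⊢GS B
  derive s = let open ContextSplitting s
                 (⊢C₁[X] , ⊢C₂) = splits′ (C₁ [ X ]⟨ R₁ ⟩) C₂ (≅-trans g (plug X))
             in ⊢C₁[X] ◅◅ rule C₁ R₁ ρ ≅-refl A≅ ◅ ε , ⊢C₂ ◅◅ iso (≅-sym B≅) ◅ ε

step-splits : ∀ {G H} → Step G H → Splits G → Splits H
step-splits (iso φ)          splits A B ψ = splits A B (≅-trans φ ψ)
step-splits (rule C R ρ g h) splits       = rule-splits {C = C} {R} splits ρ g h

splits-along : ∀ {G H} → Star Step G H → Splits G → Splits H
splits-along ε        splits = splits
splits-along (s ◅ ss) splits = splits-along ss (step-splits s splits)

-- Derivations under a tensor context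

⊗-congˡ : ∀ {G H B} → G ≅ H → G ⊗ B ≅ H ⊗ B
⊗-congˡ {G} {H} {B} φ = ≃⇒≅
  (≃-trans (⟦glue⟧ G B _) (≃-trans (Glue-cong (≅⇒≃ φ) ≃-refl (λ _ _ → refl)) (≃-sym (⟦glue⟧ H B _))))

∅⊗ : ∀ {B} → B ≅ ∅ ⊗ B
∅⊗ {B} = ≃⇒≅ (≃-sym (≃-trans (⟦glue⟧ ∅ B _) Glue-∅))
  where
  Glue-∅ : Glue ⟦ ∅ ⟧ ⟦ B ⟧ (λ _ _ → true) ≃ ⟦ B ⟧
  Glue-∅ = record
    { vertices   = mk↔ₛ′ (λ { (inj₁ ()) ; (inj₂ b) → b }) inj₂ (λ _ → refl)
                         (λ { (inj₁ ()) ; (inj₂ _) → refl })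
    ; label-pres = λ { (inj₁ ()) ; (inj₂ _) → refl }
    ; edge-pres  = λ { (inj₁ ()) _ ; (inj₂ _) (inj₁ ()) ; (inj₂ _) (inj₂ _) → refl }
    }

⊗-context : ∀ C R B X → C [ X ]⟨ R ⟩ ⊗ B ≅ (C ⊗ B) [ X ]⟨ R ++ ⊤ ⟩
⊗-context C R B X = ≃⇒≅
  (≃-trans (⟦glue⟧ (C [ X ]⟨ R ⟩) B _)
  (≃-trans (Glue-cong (⟦glue⟧ C X (hole R)) ≃-refl (λ _ _ → refl))
  (≃-trans (≃-sym (Glue-⊗′-context hole⁺ (λ _ _ → refl)))
  (≃-trans (Glue-cong (≃-sym (⟦glue⟧ C B _)) ≃-refl hole⁺-pres)
           (≃-sym (⟦glue⟧ (C ⊗ B) X _))))))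
  where
  hole⁺ : Fin (size C) ⊎ Fin (size B) → Fin (size X) → Bool
  hole⁺ (inj₁ c) _ = lookup R c
  hole⁺ (inj₂ _) _ = true
  hole⁺-pres : ∀ s x → lookup (R ++ ⊤) (join (size C) (size B) s) ≡ hole⁺ s x
  hole⁺-pres (inj₁ c) _ = lookup-++ˡ R ⊤ c
  hole⁺-pres (inj₂ b) _ = trans (lookup-++ʳ R ⊤ b) (lookup-replicate b true)

step-⊗ : ∀ {B G H} → Step G H → Step (G ⊗ B) (H ⊗ B)
step-⊗     (iso φ)                  = iso (⊗-congˡ φ)
step-⊗ {B} (rule C R {X} {Y} ρ g h) =
  rule (C ⊗ B) (R ++ ⊤) ρ (≅-trans (⊗-congˡ g) (⊗-context C R B X))
                          (≅-trans (⊗-congˡ h) (⊗-context C R B Y))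

⊢-⊗ : ∀ {A B} → ⊢GS A → ⊢GS B → ⊢GS (A ⊗ B)
⊢-⊗ {B = B} ⊢A ⊢B = ⊢B ◅◅ iso ∅⊗ ◅ gmap (_⊗ B) step-⊗ ⊢A

corollary5p9 : (A B : Graph) → (⊢GS (A ⊗ B)) ⇔ ((⊢GS A) × (⊢GS B))
corollary5p9 A B = mk⇔ (λ ⊢A⊗B → splits-along ⊢A⊗B ∅-splits A B ≅-refl)
                       (λ (⊢A , ⊢B) → ⊢-⊗ ⊢A ⊢B)
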